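{- Let $\delta<\omega^\omega$ be an ordinal and $G=(\delta,E)$ a graph. Let $A,B\subseteq\delta$ be infinite, disjoint, without maxima, and such that $A\Rightarrow\!\!\!\Rightarrow B$. Then there are a cofinal subset $A_0\subseteq A$ and a cofinite subset $B_0\subseteq B$ such that $N(b)\cap A_0$ is cofinite in $A_0$ for every $b\in B_0$.
   Context: For a vertex $v$, $N(v)=\{u:(v,u)\in E\}$ is its set of neighbours and for a set $U$ of vertices $N(U)=\bigcup_{v\in U}N(v)$. For infinite disjoint $A,B\subseteq\delta$ without maxima: write $A\Rightarrow B$ if for every cofinal subset $X$ of $A$, the set $B\setminus N(X)$ is finite; write $A\Rightarrow\!\!\!\Rightarrow B$ if $A\Rightarrow B$ and in addition $N(a)\cap B$ is finite for every $a\in A$. -}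

module Defs where

open import Data.Nat using (ℕ; _<_; _≤_)
open import Data.Vec using (Vec; []; _∷_)
open import Data.List using (List)
open import Data.List.Membership.Propositional using (_∈_)
open import Data.Product using (Σ; ∃; _×_)
open import Data.Sum using (_⊎_)
open import Data.Empty using (⊥)
open import Relation.Nullary using (¬_)
open import Relation.Binary.PropositionalEquality using (_≡_)

-- Ordinals below ω^n, in Cantor normal form with finite exponents:
-- the vector (c_{n-1} , … , c_0) denotes ω^(n-1)·c_{n-1} + … + ω·c_1 + c_0.
-- Every ordinal < ω^ω lies below some ω^n, and the ordinals < ω^n are
-- exactly these vectors, ordered lexicographically (most significant first).
Ord : ℕ → Set
Ord n = Vec ℕ n

infix 4 _<ₒ_ _≤ₒ_
data _<ₒ_ : {n : ℕ} → Ord n → Ord n → Set where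
  here  : ∀ {n x y} {xs ys : Ord n} → x < y → (x ∷ xs) <ₒ (y ∷ ys)
  there : ∀ {n x} {xs ys : Ord n} → xs <ₒ ys → (x ∷ xs) <ₒ (x ∷ ys)

_≤ₒ_ : {n : ℕ} → Ord n → Ord n → Set
α ≤ₒ β = α <ₒ β ⊎ α ≡ β

Subset : ℕ → Set₁
Subset n = Ord n → Set

module _ {n : ℕ} where

  _⊆_ : Subset n → Subset n → Set
  X ⊆ Y = ∀ α → X α → Y α

  _∖_ : Subset n → Subset n → Subset n
  (X ∖ Y) α = X α × ¬ Y α

  Finite : Subset n → Set
  Finite X = Σ (List (Ord n)) λ l → ∀ α → X α → α ∈ l

  Infinite : Subset n → Set
  Infinite X = ¬ Finite X

  Disjoint : Subset n → Subset n → Set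
  Disjoint X Y = ∀ α → X α → Y α → ⊥

  NoMax : Subset n → Set
  NoMax X = ∀ α → X α → Σ (Ord n) λ β → X β × α <ₒ β

  CofinalIn : Subset n → Subset n → Set
  CofinalIn X A = X ⊆ A × (∀ α → A α → Σ (Ord n) λ β → X β × α ≤ₒ β)

  CofiniteIn : Subset n → Subset n → Set
  CofiniteIn X A = X ⊆ A × Finite (A ∖ X)

  -- Graph on vertex set δ = {α : α <ₒ δ}; E is the edge relation.
  module _ (E : Ord n → Ord n → Set) where

    N : Ord n → Subset n
    N v u = E v u

    NSet : Subset n → Subset n
    NSet U u = Σ (Ord n) λ v → U v × E v u

    _⇒_ : Subset n → Subset n → Set₁
    A ⇒ B = (X : Subset n) → CofinalIn X A → Finite (B ∖ NSet X)

    _⇛_ : Subset n → Subset n → Set₁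
    A ⇛ B = (A ⇒ B) × (∀ a → A a → Finite (λ u → N a u × B u))

-- Fix a monotone cofinal ω-sequence a₀ ≤ a₁ ≤ … in A (ordinals below ω^ω are countable);
-- then every unbounded set I of indices gives a cofinal subset {aᵢ : i ∈ I} of A.
-- If some unbounded I makes N(b) ∩ {aᵢ : i ∈ I} cofinite for cofinitely many b ∈ B, we are done.
-- Otherwise build b₀, b₁, … ∈ B and a shrinking chain of unbounded index sets I₀ ⊇ I₁ ⊇ …:
-- bₖ is a new vertex for which {aᵢ : i ∈ Iₖ} ∖ N(bₖ) is infinite, I_{k+1} keeps the indices in Iₖ
-- not adjacent to bₖ, and yₖ ≥ k is an index in I_{k+1}. The bₖ are chosen outside the finite sets
-- N(a_{yⱼ}) ∩ B for j < k, while for j ≥ k the vertex a_{yⱼ} avoids N(bₖ) by construction.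
-- So the infinitely many bₖ lie in B ∖ N(Y) for the cofinal set Y = {a_{yₖ}}, contradicting A ⇒ B.
module Submission where

open import Defs
open import Level using (0ℓ)
open import Axiom.ExcludedMiddle using (ExcludedMiddle)
open import Data.Nat using (ℕ; zero; suc; _+_; _≤_; _<_; s≤s; _≤′_; ≤′-refl; ≤′-step; _≤?_; _<?_)
open import Data.Product using (Σ; _×_; ∃; _,_; proj₁; proj₂)
open import Relation.Nullary using (¬_; Dec; yes; no)

open import Data.Bool using (Bool; true; T; _∧_)
open import Data.Bool.Properties using (T-∧)
open import Data.Empty using (⊥; ⊥-elim)
open import Data.Fin using (toℕ)
open import Data.Fin.Properties using (pigeonhole)
open import Data.List using (List; []; _∷_; _++_; length; applyUpTo)
open import Data.List.Membership.Propositional using (_∈_; _∉_)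
open import Data.List.Membership.Propositional.Properties using (∈-++⁺ˡ; ∈-++⁺ʳ; ∈-applyUpTo⁺)
open import Data.List.Membership.Setoid.Properties using (index-injective)
open import Data.List.Relation.Unary.Any using (here; there; index)
open import Data.Nat.Properties
  using (<-cmp; <-trans; ≤-refl; ≤⇒≤′; ≰⇒>; ≮⇒≥; n<1+n; +-suc; +-identityʳ; suc-injective)
open import Data.Sum using (_⊎_; inj₁; inj₂)
open import Data.Vec using ([]; _∷_)
open import Function.Base using (_∘_)
open import Function.Bundles using (Equivalence)
open import Relation.Binary.Definitions using (tri<; tri≈; tri>)
open import Relation.Binary.PropositionalEquality using (_≡_; _≢_; refl; trans; cong; subst; setoid)
open import Relation.Nullary.Decidable using (isNo; toWitnessFalse; fromWitnessFalse)

stepwise⇒monotone : {X : Set} (R : X → X → Set) → (∀ {x} → R x x) →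
  (∀ {x y z} → R x y → R y z → R x z) →
  (f : ℕ → X) → (∀ k → R (f k) (f (suc k))) → ∀ {j k} → j ≤ k → R (f j) (f k)
stepwise⇒monotone R refl′ trans′ f step j≤k = go (≤⇒≤′ j≤k)
  where
  go : ∀ {j k} → j ≤′ k → R (f j) (f k)
  go ≤′-refl = refl′
  go (≤′-step {k} j≤′k) = trans′ (go j≤′k) (step k)

injection-unlisted : {X : Set} (f : ℕ → X) → (∀ {j k} → j < k → f j ≢ f k) →
  (L : List X) → ¬ (∀ k → f k ∈ L)
injection-unlisted f f-injective L listed
  with i , j , i<j , same ← pigeonhole (n<1+n (length L)) (λ i → index (listed (toℕ i)))
  = f-injective i<j (index-injective (setoid _) (listed (toℕ i)) (listed (toℕ j)) same)

<ₒ-trans : ∀ {n} {α β γ : Ord n} → α <ₒ β → β <ₒ γ → α <ₒ γ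
<ₒ-trans (here x<y) (here y<z) = here (<-trans x<y y<z)
<ₒ-trans (here x<y) (there _)  = here x<y
<ₒ-trans (there _)  (here y<z) = here y<z
<ₒ-trans (there p)  (there q)  = there (<ₒ-trans p q)

≤ₒ-trans : ∀ {n} {α β γ : Ord n} → α ≤ₒ β → β ≤ₒ γ → α ≤ₒ γ
≤ₒ-trans (inj₁ p)    (inj₁ q)    = inj₁ (<ₒ-trans p q)
≤ₒ-trans (inj₁ p)    (inj₂ refl) = inj₁ p
≤ₒ-trans (inj₂ refl) q           = q

≤ₒ-cons : ∀ {n x} {α β : Ord n} → α ≤ₒ β → (x ∷ α) ≤ₒ (x ∷ β)
≤ₒ-cons (inj₁ α<β)  = inj₁ (there α<β)
≤ₒ-cons (inj₂ refl) = inj₂ refl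

≤ₒ-total : ∀ {n} (α β : Ord n) → α ≤ₒ β ⊎ β ≤ₒ α
≤ₒ-total [] [] = inj₁ (inj₂ refl)
≤ₒ-total (x ∷ α) (y ∷ β) with <-cmp x y
... | tri< x<y _ _ = inj₁ (inj₁ (here x<y))
... | tri> _ _ y<x = inj₂ (inj₁ (here y<x))
... | tri≈ _ refl _ with ≤ₒ-total α β
...   | inj₁ α≤β = inj₁ (≤ₒ-cons α≤β)
...   | inj₂ β≤α = inj₂ (≤ₒ-cons β≤α)

-- Cantor's diagonal walk through ℕ × ℕ.
diagonalSucc : ℕ × ℕ → ℕ × ℕ
diagonalSucc (x , zero)  = 0 , suc x
diagonalSucc (x , suc y) = suc x , y

unpair : ℕ → ℕ × ℕ
unpair zero    = 0 , 0
unpair (suc k) = diagonalSucc (unpair k)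

unpair-surjective : ∀ x y → ∃ λ k → unpair k ≡ (x , y)
unpair-surjective x y = onDiagonal (x + y) x y refl
  where
  onDiagonal : ∀ s x y → x + y ≡ s → ∃ λ k → unpair k ≡ (x , y)
  onDiagonal s (suc x) y x+y≡s
    with k , e ← onDiagonal s x (suc y) (trans (+-suc x y) x+y≡s) = suc k , cong diagonalSucc e
  onDiagonal (suc s) zero (suc y) y≡s
    with k , e ← onDiagonal s y 0 (trans (+-identityʳ y) (suc-injective y≡s)) = suc k , cong diagonalSucc e
  onDiagonal _ zero zero _ = 0 , refl

enumerate : ∀ n → ℕ → Ord n
enumerate zero    _ = []
enumerate (suc n) k = proj₁ (unpair k) ∷ enumerate n (proj₂ (unpair k))

enumerate-surjective : ∀ n (α : Ord n) → ∃ λ k → enumerate n k ≡ α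
enumerate-surjective zero [] = 0 , refl
enumerate-surjective (suc n) (x ∷ α) with j , refl ← enumerate-surjective n α
  with k , e ← unpair-surjective x j = k , cong (λ p → proj₁ p ∷ enumerate n (proj₂ p)) e

module _ (em : ExcludedMiddle 0ℓ) {n : ℕ} {X : Subset n} where

  infinite⇒∃∉ : Infinite X → (L : List (Ord n)) → ∃ λ α → X α × α ∉ L
  infinite⇒∃∉ infinite L with em {∃ λ α → X α × α ∉ L}
  ... | yes found = found
  ... | no none = ⊥-elim (infinite (L , listed))
    where
    listed : ∀ α → X α → α ∈ L
    listed α Xα with em {α ∈ L}
    ... | yes α∈L = α∈L
    ... | no α∉L  = ⊥-elim (none (α , Xα , α∉L))

Unbounded : (ℕ → Set) → Set
Unbounded P = ∀ m → ∃ λ i → m ≤ i × P i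

record CofinalSequence {n : ℕ} (A : Subset n) : Set where
  field
    seq      : ℕ → Ord n
    seq∈     : ∀ k → A (seq k)
    monotone : ∀ {j k} → j ≤ k → seq j ≤ₒ seq k
    cofinal  : ∀ α → A α → ∃ λ k → α ≤ₒ seq k

upperBound : ∀ {n} {A : Subset n} {α} → A α → (e : Ord n) → Dec (A e) →
  ∃ λ β → A β × α ≤ₒ β × (A e → e ≤ₒ β)
upperBound {α = α} Aα e (no ¬Ae) = α , Aα , inj₂ refl , λ Ae → ⊥-elim (¬Ae Ae)
upperBound {α = α} Aα e (yes Ae) with ≤ₒ-total α e
... | inj₁ α≤e = e , Ae , α≤e , λ _ → inj₂ refl
... | inj₂ e≤α = α , Aα , inj₂ refl , λ _ → e≤α

cofinalSequence : ExcludedMiddle 0ℓ → ∀ {n} {A : Subset n} → Σ (Ord n) A → CofinalSequence A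
cofinalSequence em {n} {A} (α₀ , Aα₀) = record
  { seq      = λ k → proj₁ (stage k)
  ; seq∈     = λ k → proj₂ (stage k)
  ; monotone = stepwise⇒monotone _≤ₒ_ (inj₂ refl) ≤ₒ-trans (λ k → proj₁ (stage k))
                 (λ k → proj₁ (proj₂ (proj₂ (raise k))))
  ; cofinal  = cofinal
  }
  where
  stage : ℕ → Σ (Ord n) A
  raise : ∀ k → ∃ λ β → A β × proj₁ (stage k) ≤ₒ β × (A (enumerate n k) → enumerate n k ≤ₒ β)
  stage zero    = α₀ , Aα₀
  stage (suc k) = proj₁ (raise k) , proj₁ (proj₂ (raise k))
  raise k = upperBound (proj₂ (stage k)) (enumerate n k) em

  cofinal : ∀ α → A α → ∃ λ k → α ≤ₒ proj₁ (stage k)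
  cofinal α Aα with k , refl ← enumerate-surjective n α = suc k , proj₂ (proj₂ (proj₂ (raise k))) Aα

module _ {n : ℕ} {A : Subset n} (a : CofinalSequence A) where

  open CofinalSequence a

  values : (ℕ → Set) → Subset n
  values P α = ∃ λ i → P i × seq i ≡ α

  values-cofinal : ∀ {P} → Unbounded P → CofinalIn (values P) A
  values-cofinal {P} unbounded = (λ { _ (i , _ , refl) → seq∈ i }) , above
    where
    above : ∀ α → A α → ∃ λ β → values P β × α ≤ₒ β
    above α Aα with k , α≤aₖ ← cofinal α Aα with i , k≤i , Pᵢ ← unbounded k =
      seq i , (i , Pᵢ , refl) , ≤ₒ-trans α≤aₖ (monotone k≤i)

module Dichotomy (em : ExcludedMiddle 0ℓ) {n : ℕ} (E : Ord n → Ord n → Set)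
  (E-sym : ∀ u v → E u v → E v u) {A B : Subset n} (A⇛B : _⇛_ E A B) (a : CofinalSequence A) where

  open CofinalSequence a

  subsequence : (ℕ → Bool) → Subset n
  subsequence I = values a (T ∘ I)

  avoiding : Ord n → (ℕ → Bool) → ℕ → Bool
  avoiding b I i = I i ∧ isNo (em {E b (seq i)})

  avoiding-sound : ∀ {b I i} → T (avoiding b I i) → T (I i) × ¬ E b (seq i)
  avoiding-sound avoids with Iᵢ , nonadjacent ← Equivalence.to T-∧ avoids =
    Iᵢ , toWitnessFalse nonadjacent

  avoiding-complete : ∀ {b I i} → T (I i) → ¬ E b (seq i) → T (avoiding b I i)
  avoiding-complete Iᵢ ¬E = Equivalence.from T-∧ (Iᵢ , fromWitnessFalse ¬E)

  -- If no index past m survived, the surviving vertices would all lie among a₀ … a_{m-1}.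
  avoiding-unbounded : ∀ {b I} → Infinite (subsequence I ∖ N E b) → Unbounded (T ∘ avoiding b I)
  avoiding-unbounded {b} {I} infinite m with em {∃ λ i → m ≤ i × T (avoiding b I i)}
  ... | yes survivor = survivor
  ... | no none = ⊥-elim (infinite (applyUpTo seq m , below))
    where
    below : ∀ α → (subsequence I ∖ N E b) α → α ∈ applyUpTo seq m
    below _ ((i , Iᵢ , refl) , ¬E) with m ≤? i
    ... | yes m≤i = ⊥-elim (none (i , m≤i , avoiding-complete {I = I} Iᵢ ¬E))
    ... | no m≰i  = ∈-applyUpTo⁺ seq (≰⇒> m≰i)

  -- Index sets are Bool-valued so that "some unbounded index set is good" is a Set,
  -- to which excluded middle at level 0ℓ applies.
  Good : (ℕ → Bool) → Set
  Good I = Finite (B ∖ λ b → Finite (subsequence I ∖ N E b))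

  Conclusion : Set₁
  Conclusion = Σ (Subset n) λ A₀ → Σ (Subset n) λ B₀ →
    CofinalIn A₀ A × CofiniteIn B₀ B × (∀ b → B₀ b → Finite (A₀ ∖ N E b))

  good⇒conclusion : ∀ {I} → Unbounded (T ∘ I) → Good I → Conclusion
  good⇒conclusion {I} unbounded (L , covers) =
    subsequence I , (λ b → B b × Finite (subsequence I ∖ N E b)) ,
    values-cofinal a unbounded ,
    ((λ _ → proj₁) , L , λ b (Bb , ¬good) → covers b (Bb , λ fin → ¬good (Bb , fin))) ,
    λ _ → proj₂

  module NoGood (noGood : ¬ (∃ λ I → Unbounded (T ∘ I) × Good I)) where

    record Stage : Set where
      field
        indices   : ℕ → Bool
        unbounded : Unbounded (T ∘ indices)
        used      : List (Ord n)

    open Stage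

    record Extension (k : ℕ) (s : Stage) : Set where
      field
        vertex          : Ord n
        pivot           : ℕ
        next            : Stage
        vertex∈B        : B vertex
        vertex-fresh    : vertex ∉ used s
        vertex-used     : vertex ∈ used next
        neighbours-used : ∀ u → B u → E (seq pivot) u → u ∈ used next
        used-grows      : ∀ u → u ∈ used s → u ∈ used next
        indices-shrink  : ∀ i → T (indices next i) → T (indices s i)
        indices-avoid   : ∀ i → T (indices next i) → ¬ E vertex (seq i)
        pivot-survives  : T (indices next pivot)
        k≤pivot         : k ≤ pivot

    manyBad : ∀ s → Infinite (B ∖ λ b → Finite (subsequence (indices s) ∖ N E b))
    manyBad s fewBad = noGood (indices s , unbounded s , fewBad)

    extend : ∀ k s → Extension k s
    extend k s
      with b , (Bb , b-bad) , b-fresh ← infinite⇒∃∉ em (manyBad s) (used s)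
      with y , k≤y , y-survives ← avoiding-unbounded b-bad k
      with L , covers ← proj₂ A⇛B (seq y) (seq∈ y) = record
      { vertex = b ; pivot = y
      ; next = record
        { indices = avoiding b (indices s) ; unbounded = avoiding-unbounded b-bad ; used = b ∷ (L ++ used s) }
      ; vertex∈B = Bb ; vertex-fresh = b-fresh ; vertex-used = here refl
      ; neighbours-used = λ u Bu E-yu → there (∈-++⁺ˡ (covers u (E-yu , Bu)))
      ; used-grows = λ u u∈used → there (∈-++⁺ʳ L u∈used)
      ; indices-shrink = λ i → proj₁ ∘ avoiding-sound {b} {indices s} {i}
      ; indices-avoid = λ i → proj₂ ∘ avoiding-sound {b} {indices s} {i}
      ; pivot-survives = y-survives ; k≤pivot = k≤y
      }

    stage : ℕ → Stage
    extension : ∀ k → Extension k (stage k)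
    stage zero = record { indices = λ _ → true ; unbounded = λ m → m , ≤-refl , _ ; used = [] }
    stage (suc k) = Extension.next (extension k)
    extension k = extend k (stage k)

    module Chosen (k : ℕ) = Extension (extension k)
    open Chosen

    used-monotone : ∀ {j k} → j ≤ k → ∀ u → u ∈ used (stage j) → u ∈ used (stage k)
    used-monotone = stepwise⇒monotone (λ L L′ → ∀ u → u ∈ L → u ∈ L′) (λ _ u∈L → u∈L)
      (λ L⊆L′ L′⊆L″ u → L′⊆L″ u ∘ L⊆L′ u) (used ∘ stage) used-grows

    indices-antitone : ∀ {j k} → j ≤ k → ∀ i → T (indices (stage k) i) → T (indices (stage j) i)
    indices-antitone = stepwise⇒monotone (λ I I′ → ∀ i → T (I′ i) → T (I i)) (λ _ Iᵢ → Iᵢ)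
      (λ I′⊆I I″⊆I′ i → I′⊆I i ∘ I″⊆I′ i) (indices ∘ stage) indices-shrink

    vertex-injective : ∀ {j k} → j < k → vertex j ≢ vertex k
    vertex-injective {j} {k} j<k vⱼ≡vₖ =
      vertex-fresh k (subst (_∈ used (stage k)) vⱼ≡vₖ (used-monotone j<k (vertex j) (vertex-used j)))

    pivot-nonadjacent : ∀ j k → ¬ E (seq (pivot j)) (vertex k)
    pivot-nonadjacent j k E-jk with j <? k
    ... | yes j<k =
      vertex-fresh k (used-monotone j<k (vertex k) (neighbours-used j (vertex k) (vertex∈B k) E-jk))
    ... | no j≮k =
      indices-avoid k (pivot j) (indices-antitone (s≤s (≮⇒≥ j≮k)) (pivot j) (pivot-survives j)) (E-sym _ _ E-jk)

    pivots : Subset n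
    pivots = values a (λ i → ∃ λ j → pivot j ≡ i)

    pivots-cofinal : CofinalIn pivots A
    pivots-cofinal = values-cofinal a λ m → pivot m , k≤pivot m , m , refl

    contradiction : ⊥
    contradiction with L , covers ← proj₁ A⇛B pivots pivots-cofinal =
      injection-unlisted vertex vertex-injective L λ k →
        covers (vertex k) (vertex∈B k , λ { (_ , (_ , (j , refl) , refl) , E-jk) → pivot-nonadjacent j k E-jk })

  conclusion : Conclusion
  conclusion with em {∃ λ I → Unbounded (T ∘ I) × Good I}
  ... | yes (I , unbounded , good) = good⇒conclusion unbounded good
  ... | no noGood = ⊥-elim (NoGood.contradiction noGood)

mainTheorem13 : ExcludedMiddle 0ℓ →
    (n : ℕ) (δ : Ord n) (E : Ord n → Ord n → Set) →
    (∀ u v → E u v → E v u) → (∀ v → ¬ E v v) →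
    (A B : Subset n) →
    A ⊆ (λ α → α <ₒ δ) → B ⊆ (λ α → α <ₒ δ) →
    Infinite A → Infinite B → Disjoint A B → NoMax A → NoMax B →
    _⇛_ E A B →
    Σ (Subset n) λ A₀ → Σ (Subset n) λ B₀ →
      CofinalIn A₀ A × CofiniteIn B₀ B ×
      (∀ b → B₀ b → Finite (A₀ ∖ N E b))
mainTheorem13 em n _ E E-sym _ A B _ _ A-infinite _ _ _ _ A⇛B
  with α₀ , Aα₀ , _ ← infinite⇒∃∉ em A-infinite [] =
  Dichotomy.conclusion em E E-sym A⇛B (cofinalSequence em (α₀ , Aα₀))
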